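{- Let $a,b\geq 3$ and let $h_1,h_2,h_3$ be positive integers. Consider the sequence $P$ with $1+a+b$ entries in which position $1$ carries $h_1$, the positions in $M_2=\{2,\dots,a+1\}$ carry $h_2$, and the positions in $M_3=\{a+2,\dots,a+b+1\}$ carry $h_3$. Then an $\mathrm{ROS}(P)$ which is similar with respect to both $M_2$ and $M_3$ exists if and only if there exist rational numbers $x=X'(2,2,3)$ and $y=X'(2,3,3)$ satisfying: (1) $x,y\geq 0$; (2) $abh_2h_3\geq ab(a-1)x+ab(b-1)y\geq\max\{abh_2h_3-ah_1h_2,\ abh_2h_3-bh_1h_3\}$; (3) $2ab(a-1)x+ab(b-1)y\leq a(a-1)h_2^2-ah_1h_2+abh_2h_3$; (4) $ab(a-1)x+2ab(b-1)y\leq b(b-1)h_3^2-bh_1h_3+abh_2h_3$. Here, for such a similar $\mathrm{ROS}$ $X$, $X'(2,2,3)$ denotes the common value of $X(\alpha,\beta,\gamma)$ over distinct $\alpha,\beta\in M_2$ and $\gamma\in M_3$, and $X'(2,3,3)$ the common value of $X(\alpha,\beta,\gamma)$ over $\alpha\in M_2$ and distinct $\beta,\gamma\in M_3$.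
   Context: An $\mathrm{ROS}(P)$ for $P=(p_1,\dots,p_k)$ is an assignment of a non-negative rational number $X(i,j,\ell)$ to every multiset $\{i,j,\ell\}$ of elements of $[k]$ (invariant under permuting $i,j,\ell$) such that $\sum_{\ell\in[k]}X(i,j,\ell)=p_ip_j$ for all $i,j\in[k]$, and $X(i,i,i)=p_i^2$ and $X(i,i,j)=0$ for all $i\neq j$. If the positions of a block $M=\{c,\dots,c+m-1\}$ all carry the same part, $X$ is similar with respect to $M$ if there exist non-negative values $X'(i,j,c)$, $X'(i,c,c)$ (for $i,j\notin M$) and $X'(c,c,c)$ such that for all distinct $\alpha,\beta,\gamma\in M$ and all $i,j\notin M$: $X(i,j,\alpha)=X'(i,j,c)$, $X(i,\alpha,\beta)=X'(i,c,c)$, and $X(\alpha,\beta,\gamma)=X'(c,c,c)$. Similarity with respect to both $M_2$ and $M_3$ makes the two common values in the claim well defined. -}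

module Defs where

open import Data.Nat as ℕ using (ℕ; zero; suc)
open import Data.Fin using (Fin; toℕ) renaming (zero to fzero; suc to fsuc)
open import Data.Integer using (+_)
open import Data.Bool using (true; false)
open import Data.Rational using (ℚ; 0ℚ; 1ℚ; _+_; _-_; _⊔_; _*_; _/_; _≤_)
open import Data.Product using (Σ; _×_)
open import Relation.Binary.PropositionalEquality using (_≡_; _≢_)
open import Relation.Nullary using (¬_)

ℕ→ℚ : ℕ → ℚ
ℕ→ℚ n = + n / 1

sumFin : (k : ℕ) → (Fin k → ℚ) → ℚ
sumFin zero    f = 0ℚ
sumFin (suc k) f = f fzero + sumFin k (λ i → f (fsuc i))

-- A candidate ROS: a value for every triple (i,j,l); invariance under permuting
-- i,j,l makes it a function on multisets {i,j,l}.
Triple : ℕ → Set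
Triple k = Fin k → Fin k → Fin k → ℚ

record IsROS (k : ℕ) (p : Fin k → ℚ) (X : Triple k) : Set where
  field
    nonneg  : ∀ i j l → 0ℚ ≤ X i j l
    symm₁₂  : ∀ i j l → X i j l ≡ X j i l
    symm₂₃  : ∀ i j l → X i j l ≡ X i l j
    rowSum  : ∀ i j → sumFin k (λ l → X i j l) ≡ p i * p j
    diag    : ∀ i → X i i i ≡ p i * p i
    zeroIIJ : ∀ i j → i ≢ j → X i i j ≡ 0ℚ

-- membership of a position in the block M = {c, ..., c+m-1} (positions as 0-based Fin indices)
InBlock : {k : ℕ} → ℕ → ℕ → Fin k → Set
InBlock c m α = (c ℕ.≤ toℕ α) × (toℕ α ℕ.< c ℕ.+ m)

Similar : (k : ℕ) → (X : Triple k) → (c m : ℕ) → Set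
Similar k X c m =
  Σ (Fin k → Fin k → ℚ) λ X'ijc →
  Σ (Fin k → ℚ) λ X'icc →
  Σ ℚ λ X'ccc →
    (∀ i j → ¬ InBlock c m i → ¬ InBlock c m j → 0ℚ ≤ X'ijc i j)
  × (∀ i → ¬ InBlock c m i → 0ℚ ≤ X'icc i)
  × (0ℚ ≤ X'ccc)
  × (∀ i j α → ¬ InBlock c m i → ¬ InBlock c m j → InBlock c m α →
       X i j α ≡ X'ijc i j)
  × (∀ i α β → ¬ InBlock c m i → InBlock c m α → InBlock c m β → α ≢ β →
       X i α β ≡ X'icc i)
  × (∀ α β γ → InBlock c m α → InBlock c m β → InBlock c m γ →
       α ≢ β → β ≢ γ → α ≢ γ → X α β γ ≡ X'ccc)

-- The sequence P of length 1+a+b: position 1 (Fin index 0) carries h₁,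
-- M₂ = {2,...,a+1} (Fin indices 1..a) carry h₂, M₃ = {a+2,...,a+b+1} (Fin indices a+1..a+b) carry h₃.
Pseq : (a b h₁ h₂ h₃ : ℕ) → Fin (1 ℕ.+ a ℕ.+ b) → ℚ
Pseq a b h₁ h₂ h₃ i with toℕ i
... | zero = ℕ→ℚ h₁
... | suc n with n ℕ.<ᵇ a
...   | true  = ℕ→ℚ h₂
...   | false = ℕ→ℚ h₃

M₂ : ℕ → {k : ℕ} → Fin k → Set
M₂ a = InBlock 1 a

M₃ : ℕ → ℕ → {k : ℕ} → Fin k → Set
M₃ a b = InBlock (1 ℕ.+ a) b

Is223 : (a b : ℕ) → Triple (1 ℕ.+ a ℕ.+ b) → ℚ → Set
Is223 a b X x = ∀ α β γ → M₂ a α → M₂ a β → M₃ a b γ → α ≢ β → X α β γ ≡ x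

Is233 : (a b : ℕ) → Triple (1 ℕ.+ a ℕ.+ b) → ℚ → Set
Is233 a b X y = ∀ α β γ → M₂ a α → M₃ a b β → M₃ a b γ → β ≢ γ → X α β γ ≡ y

Conditions : (a b h₁ h₂ h₃ : ℕ) → ℚ → ℚ → Set
Conditions a b h₁ h₂ h₃ x y =
    (0ℚ ≤ x) × (0ℚ ≤ y)
  × (S ≤ A * B * H₂ * H₃)
  × ((A * B * H₂ * H₃ - A * H₁ * H₂) ⊔ (A * B * H₂ * H₃ - B * H₁ * H₃) ≤ S)
  × (ℕ→ℚ 2 * A * B * (A - 1ℚ) * x + A * B * (B - 1ℚ) * y
       ≤ A * (A - 1ℚ) * H₂ * H₂ - A * H₁ * H₂ + A * B * H₂ * H₃)
  × (A * B * (A - 1ℚ) * x + ℕ→ℚ 2 * A * B * (B - 1ℚ) * y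
       ≤ B * (B - 1ℚ) * H₃ * H₃ - B * H₁ * H₃ + A * B * H₂ * H₃)
  where
    A = ℕ→ℚ a
    B = ℕ→ℚ b
    H₁ = ℕ→ℚ h₁
    H₂ = ℕ→ℚ h₂
    H₃ = ℕ→ℚ h₃
    S = A * B * (A - 1ℚ) * x + A * B * (B - 1ℚ) * y

{-# OPTIONS --safe #-}
-- By similarity, X on three distinct positions depends only on their classes (position 1, M₂ or
-- M₃), so a similar ROS(P) is described by x, y and five further values u, v, w, s₂, s₃.  The
-- row sums of the class pairs (1,2), (1,3), (2,2), (2,3), (3,3) form a triangular linear system
-- that determines w, then u and v, then s₂ and s₃ from x and y; conversely the ROS built from
-- any nonnegative solution is similar and has these values.  Each of w, u, v, s₂, s₃ times a
-- positive constant (ab, a(a-1), b(b-1), a(a-1)(a-2), b(b-1)(b-2)) is the slack of one of the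
-- inequalities (2)–(4), so the solution is nonnegative exactly when (2)–(4) hold.
module Submission where

open import Defs
open import Data.Nat as ℕ using (ℕ; zero; suc; z≤n; s≤s)
open import Data.Fin using (Fin; toℕ; _↑ˡ_; _↑ʳ_; _≟_) renaming (zero to fzero; suc to fsuc)
open import Data.Fin.Properties using (suc-injective; toℕ<n; toℕ-↑ˡ; toℕ-↑ʳ; ↑ˡ-injective; ↑ʳ-injective)
import Data.Integer as ℤ
import Data.Integer.Properties as ℤ
import Data.Nat.Properties as ℕₚ
open import Data.List using (_∷_; [])
open import Data.Maybe using (Maybe; just; nothing)
open import Data.Nat.Coprimality using (1-coprimeTo) renaming (sym to coprime-sym)
open import Data.Rational using (ℚ; mkℚ; 0ℚ; 1ℚ; _+_; _*_; _-_; -_; _≤_; _<_; NonZero; 1/_; _÷_; positive; nonNegative)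
open import Data.Rational.Properties using () renaming (_≟_ to _≟ℚ_)
open import Data.Rational.Properties
  using (+-*-commutativeRing; normalize-coprime; /-cong; positive⁻¹; nonNegative⁻¹; nonNeg*nonNeg⇒nonNeg
        ; pos*pos⇒pos; *-cancelˡ-≤-pos; +-monoˡ-≤; +-inverseʳ; +-identityˡ; +-identityʳ; +-assoc; *-zeroʳ; *-zeroˡ
        ; *-inverseʳ; *-identityʳ; *-comm; ≤-refl; ≤-trans; <⇒≤; ⊔-lub; p≤p⊔q; p≤q⊔p; pos⇒nonZero)
open import Data.Product using (Σ; _×_; _,_)
open import Data.Vec.Functional using (updateAt)
open import Data.Vec.Functional.Properties using (updateAt-updates; updateAt-minimal)
open import Function using (const; _∘_)
open import Level using (0ℓ)
open import Relation.Binary.PropositionalEquality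
open import Relation.Nullary using (¬_; Dec; yes; no; contradiction)
open import Relation.Nullary.Reflects using (ofʸ; ofⁿ)
open import Data.Sum using (_⊎_; inj₁; inj₂)
open import Data.Bool using (true; false)
open import Tactic.RingSolver using (solve; solve-∀)
open import Tactic.RingSolver.Core.AlmostCommutativeRing using (AlmostCommutativeRing; fromCommutativeRing)

open ≡-Reasoning

ℚ-ring : AlmostCommutativeRing 0ℓ 0ℓ
ℚ-ring = fromCommutativeRing +-*-commutativeRing isZero
  where
  isZero : ∀ p → Maybe (0ℚ ≡ p)
  isZero p with 0ℚ ≟ℚ p
  ... | yes eq = just eq
  ... | no _   = nothing

ℕ→ℚ-mkℚ : ∀ n → ℕ→ℚ n ≡ mkℚ (ℤ.+ n) 0 (coprime-sym (1-coprimeTo n))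
ℕ→ℚ-mkℚ n = normalize-coprime _

ℕ→ℚ-+ : ∀ m n → ℕ→ℚ (m ℕ.+ n) ≡ ℕ→ℚ m + ℕ→ℚ n
ℕ→ℚ-+ m n rewrite ℕ→ℚ-mkℚ m | ℕ→ℚ-mkℚ n =
  /-cong {p₁ = ℤ.+ (m ℕ.+ n)} (sym (cong₂ ℤ._+_ (ℤ.*-identityʳ (ℤ.+ m)) (ℤ.*-identityʳ (ℤ.+ n)))) refl

ℕ→ℚ-nonNeg : ∀ n → 0ℚ ≤ ℕ→ℚ n
ℕ→ℚ-nonNeg n rewrite ℕ→ℚ-mkℚ n = nonNegative⁻¹ _

ℕ→ℚ-pos : ∀ {n} → 0 ℕ.< n → 0ℚ < ℕ→ℚ n
ℕ→ℚ-pos {suc n} _ rewrite ℕ→ℚ-mkℚ (suc n) = positive⁻¹ _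

ℕ→ℚ-∸ : ∀ {m n} → m ℕ.≤ n → ℕ→ℚ n - ℕ→ℚ m ≡ ℕ→ℚ (n ℕ.∸ m)
ℕ→ℚ-∸ {m} {n} m≤n = begin
  ℕ→ℚ n - ℕ→ℚ m                    ≡⟨ cong (λ t → ℕ→ℚ t - ℕ→ℚ m) (ℕₚ.m+[n∸m]≡n m≤n) ⟨
  ℕ→ℚ (m ℕ.+ (n ℕ.∸ m)) - ℕ→ℚ m    ≡⟨ cong (_- ℕ→ℚ m) (ℕ→ℚ-+ m (n ℕ.∸ m)) ⟩
  ℕ→ℚ m + ℕ→ℚ (n ℕ.∸ m) - ℕ→ℚ m    ≡⟨ cancel (ℕ→ℚ m) (ℕ→ℚ (n ℕ.∸ m)) ⟩
  ℕ→ℚ (n ℕ.∸ m)                    ∎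
  where
  cancel : ∀ p q → p + q - p ≡ q
  cancel = solve-∀ ℚ-ring

m<n⇒0<ℕ→ℚn-ℕ→ℚm : ∀ {m n} → m ℕ.< n → 0ℚ < ℕ→ℚ n - ℕ→ℚ m
m<n⇒0<ℕ→ℚn-ℕ→ℚm m<n = subst (0ℚ <_) (sym (ℕ→ℚ-∸ (ℕₚ.<⇒≤ m<n))) (ℕ→ℚ-pos (ℕₚ.m<n⇒0<n∸m m<n))

p≤q⇒0≤q-p : ∀ {p q} → p ≤ q → 0ℚ ≤ q - p
p≤q⇒0≤q-p {p} {q} p≤q = subst (_≤ q - p) (+-inverseʳ p) (+-monoˡ-≤ (- p) p≤q)

0≤q-p⇒p≤q : ∀ {p q} → 0ℚ ≤ q - p → p ≤ q
0≤q-p⇒p≤q {p} {q} 0≤q-p = subst₂ _≤_ (+-identityˡ p) (restore q p) (+-monoˡ-≤ p 0≤q-p)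
  where
  restore : ∀ q p → q - p + p ≡ q
  restore = solve-∀ ℚ-ring

*-nonNeg : ∀ {p q} → 0ℚ ≤ p → 0ℚ ≤ q → 0ℚ ≤ p * q
*-nonNeg {p} {q} 0≤p 0≤q =
  nonNegative⁻¹ (p * q) {{nonNeg*nonNeg⇒nonNeg p {{nonNegative 0≤p}} q {{nonNegative 0≤q}}}}

*-pos : ∀ {p q} → 0ℚ < p → 0ℚ < q → 0ℚ < p * q
*-pos {p} {q} 0<p 0<q = positive⁻¹ (p * q) {{pos*pos⇒pos p {{positive 0<p}} q {{positive 0<q}}}}

*-cancelˡ-nonNeg : ∀ {p q} → 0ℚ < p → 0ℚ ≤ p * q → 0ℚ ≤ q
*-cancelˡ-nonNeg {p} {q} 0<p 0≤pq = *-cancelˡ-≤-pos p {{positive 0<p}} (subst (_≤ p * q) (sym (*-zeroʳ p)) 0≤pq)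

*-÷-cancel : ∀ p q .{{_ : NonZero p}} → p * (q ÷ p) ≡ q
*-÷-cancel p q = begin
  p * (q * 1/ p) ≡⟨ swap p q (1/ p) ⟩
  q * (p * 1/ p) ≡⟨ cong (q *_) (*-inverseʳ p) ⟩
  q * 1ℚ         ≡⟨ *-identityʳ q ⟩
  q              ∎
  where
  swap : ∀ p q r → p * (q * r) ≡ q * (p * r)
  swap = solve-∀ ℚ-ring

sumFin-cong : ∀ n {f g : Fin n → ℚ} → (∀ i → f i ≡ g i) → sumFin n f ≡ sumFin n g
sumFin-cong zero    f≗g = refl
sumFin-cong (suc n) f≗g = cong₂ _+_ (f≗g fzero) (sumFin-cong n (f≗g ∘ fsuc))

sumFin-↑ : ∀ m n (f : Fin (m ℕ.+ n) → ℚ) →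
           sumFin (m ℕ.+ n) f ≡ sumFin m (f ∘ (_↑ˡ n)) + sumFin n (f ∘ (m ↑ʳ_))
sumFin-↑ zero    n f = sym (+-identityˡ _)
sumFin-↑ (suc m) n f = trans (cong (f fzero +_) (sumFin-↑ m n (f ∘ fsuc))) (sym (+-assoc (f fzero) _ _))

sumFin-const : ∀ n c → sumFin n (const c) ≡ ℕ→ℚ n * c
sumFin-const zero    c = sym (*-zeroˡ c)
sumFin-const (suc n) c = begin
  c + sumFin n (const c) ≡⟨ cong (c +_) (sumFin-const n c) ⟩
  c + ℕ→ℚ n * c          ≡⟨ factor c (ℕ→ℚ n) ⟩
  (1ℚ + ℕ→ℚ n) * c       ≡⟨ cong (_* c) (sym (ℕ→ℚ-+ 1 n)) ⟩
  ℕ→ℚ (suc n) * c        ∎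
  where
  factor : ∀ c m → c + m * c ≡ (1ℚ + m) * c
  factor = solve-∀ ℚ-ring

sumFin-exchange : ∀ n (f g : Fin n → ℚ) i → (∀ l → l ≢ i → f l ≡ g l) →
                  sumFin n f + g i ≡ sumFin n g + f i
sumFin-exchange (suc n) f g fzero f≗g = begin
  f fzero + sumFin n (f ∘ fsuc) + g fzero
    ≡⟨ cong (λ s → f fzero + s + g fzero) (sumFin-cong n λ l → f≗g (fsuc l) λ ()) ⟩
  f fzero + sumFin n (g ∘ fsuc) + g fzero
    ≡⟨ swap (f fzero) _ (g fzero) ⟩
  g fzero + sumFin n (g ∘ fsuc) + f fzero
    ∎
  where
  swap : ∀ p s q → p + s + q ≡ q + s + p
  swap = solve-∀ ℚ-ring
sumFin-exchange (suc n) f g (fsuc i) f≗g = begin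
  f fzero + sumFin n (f ∘ fsuc) + g (fsuc i)   ≡⟨ +-assoc (f fzero) _ _ ⟩
  f fzero + (sumFin n (f ∘ fsuc) + g (fsuc i)) ≡⟨ cong₂ _+_ (f≗g fzero λ ()) tail ⟩
  g fzero + (sumFin n (g ∘ fsuc) + f (fsuc i)) ≡⟨ +-assoc (g fzero) _ _ ⟨
  g fzero + sumFin n (g ∘ fsuc) + f (fsuc i)   ∎
  where
  tail : sumFin n (f ∘ fsuc) + g (fsuc i) ≡ sumFin n (g ∘ fsuc) + f (fsuc i)
  tail = sumFin-exchange n (f ∘ fsuc) (g ∘ fsuc) i λ l l≢i → f≗g (fsuc l) (l≢i ∘ suc-injective)

sumFin-exchange₂ : ∀ n (f g : Fin n → ℚ) {i j} → i ≢ j → (∀ l → l ≢ i → l ≢ j → f l ≡ g l) →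
                   sumFin n f + g i + g j ≡ sumFin n g + f i + f j
sumFin-exchange₂ n f g {i} {j} i≢j f≗g = begin
  sumFin n f + g i + g j ≡⟨ swap (sumFin n f) (g i) (g j) ⟩
  sumFin n f + g j + g i ≡⟨ cong (λ t → sumFin n f + t + g i) (h≗g j (i≢j ∘ sym)) ⟨
  sumFin n f + h j + g i ≡⟨ cong (_+ g i) (sumFin-exchange n f h j f≗h) ⟩
  sumFin n h + f j + g i ≡⟨ swap (sumFin n h) (f j) (g i) ⟩
  sumFin n h + g i + f j ≡⟨ cong (_+ f j) (sumFin-exchange n h g i h≗g) ⟩
  sumFin n g + h i + f j ≡⟨ cong (λ t → sumFin n g + t + f j) (updateAt-updates i g) ⟩
  sumFin n g + f i + f j ∎
  where
  swap : ∀ s p q → s + p + q ≡ s + q + p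
  swap = solve-∀ ℚ-ring
  h : Fin n → ℚ
  h = updateAt g i (const (f i))
  h≗g : ∀ l → l ≢ i → h l ≡ g l
  h≗g l l≢i = updateAt-minimal l i g l≢i
  f≗h : ∀ l → l ≢ j → f l ≡ h l
  f≗h l l≢j with l ≟ i
  ... | yes refl = sym (updateAt-updates i g)
  ... | no l≢i   = trans (f≗g l l≢i l≢j) (sym (h≗g l l≢i))

sumFin-single : ∀ n (f : Fin n → ℚ) i → (∀ l → l ≢ i → f l ≡ 0ℚ) → sumFin n f ≡ f i
sumFin-single n f i f≗0 = begin
  sumFin n f                ≡⟨ +-identityʳ (sumFin n f) ⟨
  sumFin n f + 0ℚ           ≡⟨ sumFin-exchange n f (const 0ℚ) i f≗0 ⟩
  sumFin n (const 0ℚ) + f i ≡⟨ cong (_+ f i) (trans (sumFin-const n 0ℚ) (*-zeroʳ (ℕ→ℚ n))) ⟩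
  0ℚ + f i                  ≡⟨ +-identityˡ (f i) ⟩
  f i                       ∎

data Class : Set where
  C₁ C₂ C₃ : Class

height : (H₁ H₂ H₃ : ℚ) → Class → ℚ
height H₁ H₂ H₃ C₁ = H₁
height H₁ H₂ H₃ C₂ = H₂
height H₁ H₂ H₃ C₃ = H₃

classSum : (A B : ℚ) → (Class → ℚ) → ℚ
classSum A B g = g C₁ + (A * g C₂ + B * g C₃)

classSum-cong : ∀ A B {g g′ : Class → ℚ} → (∀ c → g c ≡ g′ c) → classSum A B g ≡ classSum A B g′
classSum-cong A B g≗g′ = cong₂ _+_ (g≗g′ C₁) (cong₂ _+_ (cong (A *_) (g≗g′ C₂)) (cong (B *_) (g≗g′ C₃)))

#₂ #₃ : Class → ℕ
#₂ C₂ = 1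
#₂ _  = 0
#₃ C₃ = 1
#₃ _  = 0

-- The value of a similar ROS on three distinct positions, indexed by how many of them lie in M₂
-- and in M₃; u, v, w, x, y, s₂, s₃ stand for X'(1,2,2), X'(1,3,3), X'(1,2,3), X'(2,2,3),
-- X'(2,3,3), X'(2,2,2), X'(3,3,3).  The counts (0,0), (0,1), (1,0) would need position 1
-- twice, so their value 0 is never used.
countValue : (u v w x y s₂ s₃ : ℚ) → ℕ → ℕ → ℚ
countValue u v w x y s₂ s₃ 0                   0                   = 0ℚ
countValue u v w x y s₂ s₃ 0                   1                   = 0ℚ
countValue u v w x y s₂ s₃ 0                   2                   = v
countValue u v w x y s₂ s₃ 0                   (suc (suc (suc _))) = s₃
countValue u v w x y s₂ s₃ 1                   0                   = 0ℚ
countValue u v w x y s₂ s₃ 1                   1                   = w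
countValue u v w x y s₂ s₃ 1                   (suc (suc _))       = y
countValue u v w x y s₂ s₃ 2                   0                   = u
countValue u v w x y s₂ s₃ 2                   (suc _)             = x
countValue u v w x y s₂ s₃ (suc (suc (suc _))) _                   = s₂

classValue : (u v w x y s₂ s₃ : ℚ) → Class → Class → Class → ℚ
classValue u v w x y s₂ s₃ c d e =
  countValue u v w x y s₂ s₃ (#₂ c ℕ.+ #₂ d ℕ.+ #₂ e) (#₃ c ℕ.+ #₃ d ℕ.+ #₃ e)

classValue-nonNeg : ∀ {u v w x y s₂ s₃} →
                    0ℚ ≤ u → 0ℚ ≤ v → 0ℚ ≤ w → 0ℚ ≤ x → 0ℚ ≤ y → 0ℚ ≤ s₂ → 0ℚ ≤ s₃ →
                    ∀ c d e → 0ℚ ≤ classValue u v w x y s₂ s₃ c d e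
classValue-nonNeg {u} {v} {w} {x} {y} {s₂} {s₃} u≥0 v≥0 w≥0 x≥0 y≥0 s₂≥0 s₃≥0 c d e =
  go (#₂ c ℕ.+ #₂ d ℕ.+ #₂ e) (#₃ c ℕ.+ #₃ d ℕ.+ #₃ e)
  where
  go : ∀ m n → 0ℚ ≤ countValue u v w x y s₂ s₃ m n
  go 0                   0                   = ≤-refl
  go 0                   1                   = ≤-refl
  go 0                   2                   = v≥0
  go 0                   (suc (suc (suc _))) = s₃≥0
  go 1                   0                   = ≤-refl
  go 1                   1                   = w≥0
  go 1                   (suc (suc _))       = y≥0
  go 2                   0                   = u≥0
  go 2                   (suc _)             = x≥0
  go (suc (suc (suc _))) _                   = s₂≥0

module _ {u v w x y s₂ s₃ : ℚ} where
  private
    V : Class → Class → Class → ℚ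
    V = classValue u v w x y s₂ s₃

  classValue-comm₁₂ : ∀ c d e → V c d e ≡ V d c e
  classValue-comm₁₂ c d e = cong₂ (countValue u v w x y s₂ s₃)
    (cong (ℕ._+ #₂ e) (ℕₚ.+-comm (#₂ c) (#₂ d))) (cong (ℕ._+ #₃ e) (ℕₚ.+-comm (#₃ c) (#₃ d)))

  classValue-comm₂₃ : ∀ c d e → V c d e ≡ V c e d
  classValue-comm₂₃ c d e =
    cong₂ (countValue u v w x y s₂ s₃) (swap (#₂ c) (#₂ d) (#₂ e)) (swap (#₃ c) (#₃ d) (#₃ e))
    where
    swap : ∀ m n o → m ℕ.+ n ℕ.+ o ≡ m ℕ.+ o ℕ.+ n
    swap m n o = trans (ℕₚ.+-assoc m n o) (trans (cong (m ℕ.+_) (ℕₚ.+-comm n o)) (sym (ℕₚ.+-assoc m o n)))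

-- the row sum Σ_l X(i,j,l) when X(i,j,i) = X(i,j,j) = 0 and X(i,j,l) = V(cls i, cls j, cls l) otherwise
classRowSum : (A B : ℚ) → (Class → Class → Class → ℚ) → Class → Class → ℚ
classRowSum A B V ci cj = classSum A B (V ci cj) - V ci cj ci - V ci cj cj

module LinearSystem (A B H₁ H₂ H₃ x y : ℚ) where

  H : Class → ℚ
  H = height H₁ H₂ H₃

  record RowEquations (u v w s₂ s₃ : ℚ) : Set where
    field
      row₁₂ : (A - 1ℚ) * u + B * w ≡ H₁ * H₂
      row₁₃ : A * w + (B - 1ℚ) * v ≡ H₁ * H₃
      row₂₂ : u + (A - ℕ→ℚ 2) * s₂ + B * x ≡ H₂ * H₂
      row₂₃ : w + (A - 1ℚ) * x + (B - 1ℚ) * y ≡ H₂ * H₃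
      row₃₃ : v + A * y + (B - ℕ→ℚ 2) * s₃ ≡ H₃ * H₃

  module Rows (u v w s₂ s₃ : ℚ) where
    private
      V : Class → Class → Class → ℚ
      V = classValue u v w x y s₂ s₃
      rowSum : Class → Class → ℚ
      rowSum = classRowSum A B V

    rowSum₁₂ : rowSum C₁ C₂ ≡ (A - 1ℚ) * u + B * w
    rowSum₁₂ = begin
      0ℚ + (A * u + B * w) - 0ℚ - u ≡⟨ solve (A ∷ B ∷ u ∷ w ∷ []) ℚ-ring ⟩
      (A - 1ℚ) * u + B * w          ∎

    rowSum₁₃ : rowSum C₁ C₃ ≡ A * w + (B - 1ℚ) * v
    rowSum₁₃ = begin
      0ℚ + (A * w + B * v) - 0ℚ - v ≡⟨ solve (A ∷ B ∷ v ∷ w ∷ []) ℚ-ring ⟩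
      A * w + (B - 1ℚ) * v          ∎

    rowSum₂₂ : rowSum C₂ C₂ ≡ u + (A - ℕ→ℚ 2) * s₂ + B * x
    rowSum₂₂ = begin
      u + (A * s₂ + B * x) - s₂ - s₂ ≡⟨ solve (A ∷ B ∷ u ∷ x ∷ s₂ ∷ []) ℚ-ring ⟩
      u + (A - ℕ→ℚ 2) * s₂ + B * x   ∎

    rowSum₂₃ : rowSum C₂ C₃ ≡ w + (A - 1ℚ) * x + (B - 1ℚ) * y
    rowSum₂₃ = begin
      w + (A * x + B * y) - x - y      ≡⟨ solve (A ∷ B ∷ w ∷ x ∷ y ∷ []) ℚ-ring ⟩
      w + (A - 1ℚ) * x + (B - 1ℚ) * y ∎

    rowSum₃₃ : rowSum C₃ C₃ ≡ v + A * y + (B - ℕ→ℚ 2) * s₃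
    rowSum₃₃ = begin
      v + (A * y + B * s₃) - s₃ - s₃ ≡⟨ solve (A ∷ B ∷ v ∷ y ∷ s₃ ∷ []) ℚ-ring ⟩
      v + A * y + (B - ℕ→ℚ 2) * s₃   ∎

    rowSum-swap : ∀ ci cj → rowSum cj ci ≡ rowSum ci cj
    rowSum-swap ci cj = begin
      classSum A B (V cj ci) - V cj ci cj - V cj ci ci
        ≡⟨ cong₂ _-_ (cong₂ _-_ (classSum-cong A B (comm cj ci)) (comm cj ci cj)) (comm cj ci ci) ⟩
      classSum A B (V ci cj) - V ci cj cj - V ci cj ci
        ≡⟨ sub-swap (classSum A B (V ci cj)) (V ci cj cj) (V ci cj ci) ⟩
      classSum A B (V ci cj) - V ci cj ci - V ci cj cj
        ∎
      where
      comm : ∀ c d e → V c d e ≡ V d c e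
      comm = classValue-comm₁₂
      sub-swap : ∀ s p q → s - p - q ≡ s - q - p
      sub-swap = solve-∀ ℚ-ring

    rowEquations⇒rowSums : RowEquations u v w s₂ s₃ → ∀ ci cj → (ci ≡ C₁ → cj ≢ C₁) → rowSum ci cj ≡ H ci * H cj
    rowEquations⇒rowSums eqs C₁ C₁ ¬both = contradiction refl (¬both refl)
    rowEquations⇒rowSums eqs C₁ C₂ _ = trans rowSum₁₂ row₁₂ where open RowEquations eqs
    rowEquations⇒rowSums eqs C₁ C₃ _ = trans rowSum₁₃ row₁₃ where open RowEquations eqs
    rowEquations⇒rowSums eqs C₂ C₂ _ = trans rowSum₂₂ row₂₂ where open RowEquations eqs
    rowEquations⇒rowSums eqs C₂ C₃ _ = trans rowSum₂₃ row₂₃ where open RowEquations eqs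
    rowEquations⇒rowSums eqs C₃ C₃ _ = trans rowSum₃₃ row₃₃ where open RowEquations eqs
    rowEquations⇒rowSums eqs C₂ C₁ _ =
      trans (rowSum-swap C₁ C₂) (trans (rowEquations⇒rowSums eqs C₁ C₂ λ _ ()) (*-comm H₁ H₂))
    rowEquations⇒rowSums eqs C₃ C₁ _ =
      trans (rowSum-swap C₁ C₃) (trans (rowEquations⇒rowSums eqs C₁ C₃ λ _ ()) (*-comm H₁ H₃))
    rowEquations⇒rowSums eqs C₃ C₂ _ =
      trans (rowSum-swap C₂ C₃) (trans (rowEquations⇒rowSums eqs C₂ C₃ λ ()) (*-comm H₂ H₃))

  -- The proofs below spell S out as S′ because the ring solver does not unfold definitions.
  S : ℚ
  S = A * B * (A - 1ℚ) * x + A * B * (B - 1ℚ) * y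

  module _ {u v w s₂ s₃ : ℚ} (eqs : RowEquations u v w s₂ s₃) where
    open RowEquations eqs

    slack-w : A * B * w ≡ A * B * H₂ * H₃ - S
    slack-w = let S′ = A * B * (A - 1ℚ) * x + A * B * (B - 1ℚ) * y in begin
      A * B * w                                          ≡⟨ solve (A ∷ B ∷ w ∷ x ∷ y ∷ []) ℚ-ring ⟩
      A * B * (w + (A - 1ℚ) * x + (B - 1ℚ) * y) - S′     ≡⟨ cong (λ t → A * B * t - S′) row₂₃ ⟩
      A * B * (H₂ * H₃) - S′                             ≡⟨ solve (A ∷ B ∷ H₂ ∷ H₃ ∷ x ∷ y ∷ []) ℚ-ring ⟩
      A * B * H₂ * H₃ - S′                               ∎

    slack-u : A * (A - 1ℚ) * u ≡ S - (A * B * H₂ * H₃ - A * H₁ * H₂)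
    slack-u = let S′ = A * B * (A - 1ℚ) * x + A * B * (B - 1ℚ) * y in begin
      A * (A - 1ℚ) * u                              ≡⟨ solve (A ∷ B ∷ u ∷ w ∷ []) ℚ-ring ⟩
      A * ((A - 1ℚ) * u + B * w) - A * B * w        ≡⟨ cong₂ (λ p q → A * p - q) row₁₂ slack-w ⟩
      A * (H₁ * H₂) - (A * B * H₂ * H₃ - S′)        ≡⟨ solve (A ∷ B ∷ H₁ ∷ H₂ ∷ H₃ ∷ x ∷ y ∷ []) ℚ-ring ⟩
      S′ - (A * B * H₂ * H₃ - A * H₁ * H₂)          ∎

    slack-v : B * (B - 1ℚ) * v ≡ S - (A * B * H₂ * H₃ - B * H₁ * H₃)
    slack-v = let S′ = A * B * (A - 1ℚ) * x + A * B * (B - 1ℚ) * y in begin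
      B * (B - 1ℚ) * v                              ≡⟨ solve (A ∷ B ∷ v ∷ w ∷ []) ℚ-ring ⟩
      B * (A * w + (B - 1ℚ) * v) - A * B * w        ≡⟨ cong₂ (λ p q → B * p - q) row₁₃ slack-w ⟩
      B * (H₁ * H₃) - (A * B * H₂ * H₃ - S′)        ≡⟨ solve (A ∷ B ∷ H₁ ∷ H₂ ∷ H₃ ∷ x ∷ y ∷ []) ℚ-ring ⟩
      S′ - (A * B * H₂ * H₃ - B * H₁ * H₃)          ∎

    slack-s₂ : A * (A - 1ℚ) * (A - ℕ→ℚ 2) * s₂
             ≡ (A * (A - 1ℚ) * H₂ * H₂ - A * H₁ * H₂ + A * B * H₂ * H₃)
               - (ℕ→ℚ 2 * A * B * (A - 1ℚ) * x + A * B * (B - 1ℚ) * y)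
    slack-s₂ = let S′ = A * B * (A - 1ℚ) * x + A * B * (B - 1ℚ) * y in begin
      A * (A - 1ℚ) * (A - ℕ→ℚ 2) * s₂
        ≡⟨ solve (A ∷ B ∷ u ∷ x ∷ s₂ ∷ []) ℚ-ring ⟩
      A * (A - 1ℚ) * (u + (A - ℕ→ℚ 2) * s₂ + B * x) - A * (A - 1ℚ) * u - A * B * (A - 1ℚ) * x
        ≡⟨ cong₂ (λ p q → A * (A - 1ℚ) * p - q - A * B * (A - 1ℚ) * x) row₂₂ slack-u ⟩
      A * (A - 1ℚ) * (H₂ * H₂) - (S′ - (A * B * H₂ * H₃ - A * H₁ * H₂)) - A * B * (A - 1ℚ) * x
        ≡⟨ solve (A ∷ B ∷ H₁ ∷ H₂ ∷ H₃ ∷ x ∷ y ∷ []) ℚ-ring ⟩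
      (A * (A - 1ℚ) * H₂ * H₂ - A * H₁ * H₂ + A * B * H₂ * H₃) - (ℕ→ℚ 2 * A * B * (A - 1ℚ) * x + A * B * (B - 1ℚ) * y)
        ∎

    slack-s₃ : B * (B - 1ℚ) * (B - ℕ→ℚ 2) * s₃
             ≡ (B * (B - 1ℚ) * H₃ * H₃ - B * H₁ * H₃ + A * B * H₂ * H₃)
               - (A * B * (A - 1ℚ) * x + ℕ→ℚ 2 * A * B * (B - 1ℚ) * y)
    slack-s₃ = let S′ = A * B * (A - 1ℚ) * x + A * B * (B - 1ℚ) * y in begin
      B * (B - 1ℚ) * (B - ℕ→ℚ 2) * s₃
        ≡⟨ solve (A ∷ B ∷ v ∷ y ∷ s₃ ∷ []) ℚ-ring ⟩
      B * (B - 1ℚ) * (v + A * y + (B - ℕ→ℚ 2) * s₃) - B * (B - 1ℚ) * v - A * B * (B - 1ℚ) * y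
        ≡⟨ cong₂ (λ p q → B * (B - 1ℚ) * p - q - A * B * (B - 1ℚ) * y) row₃₃ slack-v ⟩
      B * (B - 1ℚ) * (H₃ * H₃) - (S′ - (A * B * H₂ * H₃ - B * H₁ * H₃)) - A * B * (B - 1ℚ) * y
        ≡⟨ solve (A ∷ B ∷ H₁ ∷ H₂ ∷ H₃ ∷ x ∷ y ∷ []) ℚ-ring ⟩
      (B * (B - 1ℚ) * H₃ * H₃ - B * H₁ * H₃ + A * B * H₂ * H₃) - (A * B * (A - 1ℚ) * x + ℕ→ℚ 2 * A * B * (B - 1ℚ) * y)
        ∎

  record Solution : Set where
    field
      u v w s₂ s₃ : ℚ
      u≥0 : 0ℚ ≤ u
      v≥0 : 0ℚ ≤ v
      w≥0 : 0ℚ ≤ w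
      s₂≥0 : 0ℚ ≤ s₂
      s₃≥0 : 0ℚ ≤ s₃
      equations : RowEquations u v w s₂ s₃

  module BackSubstitution .{{_ : NonZero (A - 1ℚ)}} .{{_ : NonZero (B - 1ℚ)}}
                          .{{_ : NonZero (A - ℕ→ℚ 2)}} .{{_ : NonZero (B - ℕ→ℚ 2)}} where
    w₀ u₀ v₀ s₂₀ s₃₀ : ℚ
    w₀  = H₂ * H₃ - (A - 1ℚ) * x - (B - 1ℚ) * y
    u₀  = (H₁ * H₂ - B * w₀) ÷ (A - 1ℚ)
    v₀  = (H₁ * H₃ - A * w₀) ÷ (B - 1ℚ)
    s₂₀ = (H₂ * H₂ - u₀ - B * x) ÷ (A - ℕ→ℚ 2)
    s₃₀ = (H₃ * H₃ - v₀ - A * y) ÷ (B - ℕ→ℚ 2)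

    back-substituted : RowEquations u₀ v₀ w₀ s₂₀ s₃₀
    back-substituted = record
      { row₁₂ = trans (cong (_+ B * w₀) (*-÷-cancel (A - 1ℚ) (H₁ * H₂ - B * w₀)))
                      (cancel₁ (H₁ * H₂) (B * w₀))
      ; row₁₃ = trans (cong (A * w₀ +_) (*-÷-cancel (B - 1ℚ) (H₁ * H₃ - A * w₀)))
                      (cancel₂ (H₁ * H₃) (A * w₀))
      ; row₂₂ = trans (cong (λ t → u₀ + t + B * x) (*-÷-cancel (A - ℕ→ℚ 2) (H₂ * H₂ - u₀ - B * x)))
                      (cancel₃ (H₂ * H₂) u₀ (B * x))
      ; row₂₃ = cancel₄ (H₂ * H₃) ((A - 1ℚ) * x) ((B - 1ℚ) * y)
      ; row₃₃ = trans (cong (v₀ + A * y +_) (*-÷-cancel (B - ℕ→ℚ 2) (H₃ * H₃ - v₀ - A * y)))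
                      (cancel₅ (H₃ * H₃) v₀ (A * y))
      }
      where
      cancel₁ : ∀ p q → p - q + q ≡ p
      cancel₁ = solve-∀ ℚ-ring
      cancel₂ : ∀ p q → q + (p - q) ≡ p
      cancel₂ = solve-∀ ℚ-ring
      cancel₃ : ∀ p q r → q + (p - q - r) + r ≡ p
      cancel₃ = solve-∀ ℚ-ring
      cancel₄ : ∀ p q r → p - q - r + q + r ≡ p
      cancel₄ = solve-∀ ℚ-ring
      cancel₅ : ∀ p q r → q + r + (p - q - r) ≡ p
      cancel₅ = solve-∀ ℚ-ring

module Conditions⇔Solution (a b h₁ h₂ h₃ : ℕ) (x y : ℚ) (2<a : 2 ℕ.< a) (2<b : 2 ℕ.< b) where
  private
    A B H₁ H₂ H₃ lower₂ lower₃ : ℚ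
    A = ℕ→ℚ a
    B = ℕ→ℚ b
    H₁ = ℕ→ℚ h₁
    H₂ = ℕ→ℚ h₂
    H₃ = ℕ→ℚ h₃
    lower₂ = A * B * H₂ * H₃ - A * H₁ * H₂
    lower₃ = A * B * H₂ * H₃ - B * H₁ * H₃
    0<A : 0ℚ < A
    0<A = ℕ→ℚ-pos (ℕₚ.≤-trans (s≤s z≤n) 2<a)
    0<B : 0ℚ < B
    0<B = ℕ→ℚ-pos (ℕₚ.≤-trans (s≤s z≤n) 2<b)
    0<A-1 : 0ℚ < A - 1ℚ
    0<A-1 = m<n⇒0<ℕ→ℚn-ℕ→ℚm (ℕₚ.≤-trans (s≤s (s≤s z≤n)) 2<a)
    0<B-1 : 0ℚ < B - 1ℚ
    0<B-1 = m<n⇒0<ℕ→ℚn-ℕ→ℚm (ℕₚ.≤-trans (s≤s (s≤s z≤n)) 2<b)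
    0<A-2 : 0ℚ < A - ℕ→ℚ 2
    0<A-2 = m<n⇒0<ℕ→ℚn-ℕ→ℚm 2<a
    0<B-2 : 0ℚ < B - ℕ→ℚ 2
    0<B-2 = m<n⇒0<ℕ→ℚn-ℕ→ℚm 2<b

  open LinearSystem A B H₁ H₂ H₃ x y

  solution⇒conditions : 0ℚ ≤ x → 0ℚ ≤ y → Solution → Conditions a b h₁ h₂ h₃ x y
  solution⇒conditions 0≤x 0≤y sol =
    0≤x , 0≤y ,
    from-slack (*-pos 0<A 0<B) w≥0 (slack-w equations) ,
    ⊔-lub (from-slack (*-pos 0<A 0<A-1) u≥0 (slack-u equations))
          (from-slack (*-pos 0<B 0<B-1) v≥0 (slack-v equations)) ,
    from-slack (*-pos (*-pos 0<A 0<A-1) 0<A-2) s₂≥0 (slack-s₂ equations) ,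
    from-slack (*-pos (*-pos 0<B 0<B-1) 0<B-2) s₃≥0 (slack-s₃ equations)
    where
    open Solution sol
    from-slack : ∀ {c t p q} → 0ℚ < c → 0ℚ ≤ t → c * t ≡ q - p → p ≤ q
    from-slack 0<c 0≤t c*t≡q-p = 0≤q-p⇒p≤q (subst (0ℚ ≤_) c*t≡q-p (*-nonNeg (<⇒≤ 0<c) 0≤t))

  conditions⇒solution : Conditions a b h₁ h₂ h₃ x y → Solution
  conditions⇒solution (_ , _ , upper , lower , bound₂ , bound₃) = record
    { u = u₀ ; v = v₀ ; w = w₀ ; s₂ = s₂₀ ; s₃ = s₃₀
    ; u≥0  = to-slack (*-pos 0<A 0<A-1) (slack-u back-substituted) (≤-trans (p≤p⊔q lower₂ lower₃) lower)
    ; v≥0  = to-slack (*-pos 0<B 0<B-1) (slack-v back-substituted) (≤-trans (p≤q⊔p lower₂ lower₃) lower)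
    ; w≥0  = to-slack (*-pos 0<A 0<B) (slack-w back-substituted) upper
    ; s₂≥0 = to-slack (*-pos (*-pos 0<A 0<A-1) 0<A-2) (slack-s₂ back-substituted) bound₂
    ; s₃≥0 = to-slack (*-pos (*-pos 0<B 0<B-1) 0<B-2) (slack-s₃ back-substituted) bound₃
    ; equations = back-substituted
    }
    where
    nonZero : ∀ {p} → 0ℚ < p → NonZero p
    nonZero {p} 0<p = pos⇒nonZero p {{positive 0<p}}
    open BackSubstitution {{nonZero 0<A-1}} {{nonZero 0<B-1}} {{nonZero 0<A-2}} {{nonZero 0<B-2}}
    to-slack : ∀ {c t p q} → 0ℚ < c → c * t ≡ q - p → p ≤ q → 0ℚ ≤ t
    to-slack 0<c c*t≡q-p p≤q = *-cancelˡ-nonNeg 0<c (subst (0ℚ ≤_) (sym c*t≡q-p) (p≤q⇒0≤q-p p≤q))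

module Positions (a b : ℕ) where
  private
    k : ℕ
    k = 1 ℕ.+ a ℕ.+ b

  classOf : ℕ → Class
  classOf zero = C₁
  classOf (suc n) with n ℕ.<ᵇ a
  ... | true  = C₂
  ... | false = C₃

  cls : Fin k → Class
  cls l = classOf (toℕ l)

  Pseq-height : ∀ h₁ h₂ h₃ l → Pseq a b h₁ h₂ h₃ l ≡ height (ℕ→ℚ h₁) (ℕ→ℚ h₂) (ℕ→ℚ h₃) (cls l)
  Pseq-height h₁ h₂ h₃ l with toℕ l
  ... | zero = refl
  ... | suc n with n ℕ.<ᵇ a
  ...   | true  = refl
  ...   | false = refl

  M₂⇒C₂ : ∀ {l} → M₂ a l → cls l ≡ C₂
  M₂⇒C₂ {l} (1≤l , l<1+a) = go (toℕ l) 1≤l l<1+a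
    where
    go : ∀ n → 1 ℕ.≤ n → n ℕ.< 1 ℕ.+ a → classOf n ≡ C₂
    go (suc n) _ (s≤s n<a) with n ℕ.<ᵇ a | ℕₚ.<ᵇ-reflects-< n a
    ... | true  | _       = refl
    ... | false | ofⁿ n≮a = contradiction n<a n≮a

  M₃⇒C₃ : ∀ {l} → M₃ a b l → cls l ≡ C₃
  M₃⇒C₃ {l} (1+a≤l , _) = go (toℕ l) 1+a≤l
    where
    go : ∀ n → 1 ℕ.+ a ℕ.≤ n → classOf n ≡ C₃
    go (suc n) (s≤s a≤n) with n ℕ.<ᵇ a | ℕₚ.<ᵇ-reflects-< n a
    ... | true  | ofʸ n<a = contradiction a≤n (ℕₚ.<⇒≱ n<a)
    ... | false | _       = refl

  C₁⇒fzero : ∀ {l} → cls l ≡ C₁ → l ≡ fzero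
  C₁⇒fzero {fzero}  _ = refl
  C₁⇒fzero {fsuc l} eq with toℕ l ℕ.<ᵇ a
  C₁⇒fzero {fsuc l} () | true
  C₁⇒fzero {fsuc l} () | false

  position : ∀ (l : Fin k) → l ≡ fzero ⊎ M₂ a l ⊎ M₃ a b l
  position fzero = inj₁ refl
  position (fsuc l) with toℕ l ℕ.<? a
  ... | yes l<a = inj₂ (inj₁ (s≤s z≤n , s≤s l<a))
  ... | no  l≮a = inj₂ (inj₂ (s≤s (ℕₚ.≮⇒≥ l≮a) , toℕ<n (fsuc l)))

  fzero∉M₂ : ¬ M₂ a (fzero {a ℕ.+ b})
  fzero∉M₂ (() , _)

  fzero∉M₃ : ¬ M₃ a b (fzero {a ℕ.+ b})
  fzero∉M₃ (() , _)

  M₂⇒∉M₃ : ∀ {l : Fin k} → M₂ a l → ¬ M₃ a b l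
  M₂⇒∉M₃ (_ , l<1+a) (1+a≤l , _) = ℕₚ.<⇒≱ l<1+a 1+a≤l

  M₃⇒∉M₂ : ∀ {l : Fin k} → M₃ a b l → ¬ M₂ a l
  M₃⇒∉M₂ l∈M₃ l∈M₂ = M₂⇒∉M₃ l∈M₂ l∈M₃

  pos₂ : Fin a → Fin k
  pos₂ i = fsuc (i ↑ˡ b)

  pos₃ : Fin b → Fin k
  pos₃ j = fsuc (a ↑ʳ j)

  pos₂∈M₂ : ∀ i → M₂ a (pos₂ i)
  pos₂∈M₂ i = s≤s z≤n , s≤s (subst (ℕ._< a) (sym (toℕ-↑ˡ i b)) (toℕ<n i))

  pos₃∈M₃ : ∀ j → M₃ a b (pos₃ j)
  pos₃∈M₃ j = s≤s (subst (a ℕ.≤_) (sym (toℕ-↑ʳ a j)) (ℕₚ.m≤m+n a (toℕ j))) , toℕ<n (pos₃ j)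

  pos₂-injective : ∀ {i i′} → pos₂ i ≡ pos₂ i′ → i ≡ i′
  pos₂-injective = ↑ˡ-injective b _ _ ∘ suc-injective

  pos₃-injective : ∀ {j j′} → pos₃ j ≡ pos₃ j′ → j ≡ j′
  pos₃-injective = ↑ʳ-injective a _ _ ∘ suc-injective

  sumFin-classes : ∀ g → sumFin k (g ∘ cls) ≡ classSum (ℕ→ℚ a) (ℕ→ℚ b) g
  sumFin-classes g = cong (g C₁ +_) (begin
    sumFin (a ℕ.+ b) (g ∘ cls ∘ fsuc)                    ≡⟨ sumFin-↑ a b (g ∘ cls ∘ fsuc) ⟩
    sumFin a (g ∘ cls ∘ pos₂) + sumFin b (g ∘ cls ∘ pos₃) ≡⟨ cong₂ _+_ on-M₂ on-M₃ ⟩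
    sumFin a (const (g C₂)) + sumFin b (const (g C₃))   ≡⟨ cong₂ _+_ (sumFin-const a (g C₂)) (sumFin-const b (g C₃)) ⟩
    ℕ→ℚ a * g C₂ + ℕ→ℚ b * g C₃                          ∎)
    where
    on-M₂ : sumFin a (g ∘ cls ∘ pos₂) ≡ sumFin a (const (g C₂))
    on-M₂ = sumFin-cong a (cong g ∘ M₂⇒C₂ ∘ pos₂∈M₂)
    on-M₃ : sumFin b (g ∘ cls ∘ pos₃) ≡ sumFin b (const (g C₃))
    on-M₃ = sumFin-cong b (cong g ∘ M₃⇒C₃ ∘ pos₃∈M₃)

  classwise : ∀ {f : Fin k → ℚ} {g : Class → ℚ} {i j} →
              (fzero ≢ i → fzero ≢ j → f fzero ≡ g C₁) →
              (∀ l → M₂ a l → l ≢ i → l ≢ j → f l ≡ g C₂) →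
              (∀ l → M₃ a b l → l ≢ i → l ≢ j → f l ≡ g C₃) →
              ∀ l → l ≢ i → l ≢ j → f l ≡ g (cls l)
  classwise {g = g} at₁ at₂ at₃ l l≢i l≢j with position l
  ... | inj₁ refl        = at₁ l≢i l≢j
  ... | inj₂ (inj₁ l∈M₂) = trans (at₂ l l∈M₂ l≢i l≢j) (cong g (sym (M₂⇒C₂ l∈M₂)))
  ... | inj₂ (inj₂ l∈M₃) = trans (at₃ l l∈M₃ l≢i l≢j) (cong g (sym (M₃⇒C₃ l∈M₃)))

  sumFin-classwise : ∀ {f : Fin k → ℚ} {g : Class → ℚ} {i j} → i ≢ j → f i ≡ 0ℚ → f j ≡ 0ℚ →
                     (∀ l → l ≢ i → l ≢ j → f l ≡ g (cls l)) →
                     sumFin k f ≡ classSum (ℕ→ℚ a) (ℕ→ℚ b) g - g (cls i) - g (cls j)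
  sumFin-classwise {f} {g} {i} {j} i≢j fi≡0 fj≡0 f≗g = begin
    sumFin k f                                    ≡⟨ add-sub (sumFin k f) (g (cls i)) (g (cls j)) ⟩
    strip (sumFin k f + g (cls i) + g (cls j))     ≡⟨ cong strip (sumFin-exchange₂ k f (g ∘ cls) i≢j f≗g) ⟩
    strip (sum + f i + f j)                        ≡⟨ cong strip (cong₂ (λ p q → sum + p + q) fi≡0 fj≡0) ⟩
    strip (sum + 0ℚ + 0ℚ)                          ≡⟨ cong strip (trans (+-identityʳ (sum + 0ℚ)) (+-identityʳ sum)) ⟩
    strip sum                                      ≡⟨ cong strip (sumFin-classes g) ⟩
    strip (classSum (ℕ→ℚ a) (ℕ→ℚ b) g)             ∎
    where
    sum : ℚ
    sum = sumFin k (g ∘ cls)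
    strip : ℚ → ℚ
    strip t = t - g (cls i) - g (cls j)
    add-sub : ∀ s p q → s ≡ s + p + q - p - q
    add-sub = solve-∀ ℚ-ring

module ROS {k} {p : Fin k → ℚ} {X : Triple k} (ros : IsROS k p X) where
  open IsROS ros public

  rotate : ∀ i j l → X i j l ≡ X l i j
  rotate i j l = trans (symm₂₃ i j l) (symm₁₂ i l j)

  X-iji≡0 : ∀ {i j} → i ≢ j → X i j i ≡ 0ℚ
  X-iji≡0 {i} {j} i≢j = trans (symm₂₃ i j i) (zeroIIJ i j i≢j)

  X-ijj≡0 : ∀ {i j} → i ≢ j → X i j j ≡ 0ℚ
  X-ijj≡0 {i} {j} i≢j = trans (symm₁₂ i j j) (trans (symm₂₃ j i j) (zeroIIJ j i (i≢j ∘ sym)))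

module _ {k} {X : Triple k} {c m : ℕ} where
  private
    In : Fin k → Set
    In = InBlock c m

  similar-outer : Similar k X c m → ∀ {i j α α′} → ¬ In i → ¬ In j → In α → In α′ → X i j α ≡ X i j α′
  similar-outer (_ , _ , _ , _ , _ , _ , outer , _ , _) i∉ j∉ α∈ α′∈ =
    trans (outer _ _ _ i∉ j∉ α∈) (sym (outer _ _ _ i∉ j∉ α′∈))

  similar-pair : Similar k X c m → ∀ {i α β α′ β′} → ¬ In i →
                 In α → In β → α ≢ β → In α′ → In β′ → α′ ≢ β′ → X i α β ≡ X i α′ β′
  similar-pair (_ , _ , _ , _ , _ , _ , _ , pair , _) i∉ α∈ β∈ α≢β α′∈ β′∈ α′≢β′ =
    trans (pair _ _ _ i∉ α∈ β∈ α≢β) (sym (pair _ _ _ i∉ α′∈ β′∈ α′≢β′))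

  similar-inner : Similar k X c m → ∀ {α β γ α′ β′ γ′} →
                  In α → In β → In γ → α ≢ β → β ≢ γ → α ≢ γ →
                  In α′ → In β′ → In γ′ → α′ ≢ β′ → β′ ≢ γ′ → α′ ≢ γ′ → X α β γ ≡ X α′ β′ γ′
  similar-inner (_ , _ , _ , _ , _ , _ , _ , _ , inner)
                α∈ β∈ γ∈ α≢β β≢γ α≢γ α′∈ β′∈ γ′∈ α′≢β′ β′≢γ′ α′≢γ′ =
    trans (inner _ _ _ α∈ β∈ γ∈ α≢β β≢γ α≢γ) (sym (inner _ _ _ α′∈ β′∈ γ′∈ α′≢β′ β′≢γ′ α′≢γ′))

∈∉⇒≢ : ∀ {k} {P : Fin k → Set} {l l′} → P l → ¬ P l′ → l ≢ l′
∈∉⇒≢ {P = P} l∈ l′∉ l≡l′ = l′∉ (subst P l≡l′ l∈)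

module Forward (a₀ b₀ h₁ h₂ h₃ : ℕ) where
  private
    a b k : ℕ
    a = 3 ℕ.+ a₀
    b = 3 ℕ.+ b₀
    k = 1 ℕ.+ a ℕ.+ b
    2<a : 2 ℕ.< a
    2<a = s≤s (s≤s (s≤s z≤n))
    2<b : 2 ℕ.< b
    2<b = s≤s (s≤s (s≤s z≤n))
    H : Class → ℚ
    H = height (ℕ→ℚ h₁) (ℕ→ℚ h₂) (ℕ→ℚ h₃)
  open Positions a b

  module _ (X : Triple k) (ros : IsROS k (Pseq a b h₁ h₂ h₃) X)
           (sim₂ : Similar k X 1 a) (sim₃ : Similar k X (1 ℕ.+ a) b) where
    open ROS ros

    private
      o α₁ α₂ α₃ γ₁ γ₂ γ₃ : Fin k
      o  = fzero
      α₁ = pos₂ fzero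
      α₂ = pos₂ (fsuc fzero)
      α₃ = pos₂ (fsuc (fsuc fzero))
      γ₁ = pos₃ fzero
      γ₂ = pos₃ (fsuc fzero)
      γ₃ = pos₃ (fsuc (fsuc fzero))
      α₁∈ : M₂ a α₁
      α₁∈ = pos₂∈M₂ fzero
      α₂∈ : M₂ a α₂
      α₂∈ = pos₂∈M₂ (fsuc fzero)
      α₃∈ : M₂ a α₃
      α₃∈ = pos₂∈M₂ (fsuc (fsuc fzero))
      γ₁∈ : M₃ a b γ₁
      γ₁∈ = pos₃∈M₃ fzero
      γ₂∈ : M₃ a b γ₂
      γ₂∈ = pos₃∈M₃ (fsuc fzero)
      γ₃∈ : M₃ a b γ₃
      γ₃∈ = pos₃∈M₃ (fsuc (fsuc fzero))
      α₁≢α₂ : α₁ ≢ α₂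
      α₁≢α₂ = (λ ()) ∘ pos₂-injective
      α₂≢α₃ : α₂ ≢ α₃
      α₂≢α₃ = (λ ()) ∘ pos₂-injective
      α₁≢α₃ : α₁ ≢ α₃
      α₁≢α₃ = (λ ()) ∘ pos₂-injective
      γ₁≢γ₂ : γ₁ ≢ γ₂
      γ₁≢γ₂ = (λ ()) ∘ pos₃-injective
      γ₂≢γ₃ : γ₂ ≢ γ₃
      γ₂≢γ₃ = (λ ()) ∘ pos₃-injective
      γ₁≢γ₃ : γ₁ ≢ γ₃
      γ₁≢γ₃ = (λ ()) ∘ pos₃-injective

    u v w x y s₂ s₃ : ℚ
    u  = X o α₁ α₂
    v  = X o γ₁ γ₂
    w  = X o α₁ γ₁
    x  = X α₁ α₂ γ₁
    y  = X α₁ γ₁ γ₂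
    s₂ = X α₁ α₂ α₃
    s₃ = X γ₁ γ₂ γ₃

    u-common : ∀ {α β} → M₂ a α → M₂ a β → α ≢ β → X o α β ≡ u
    u-common α∈ β∈ α≢β = similar-pair sim₂ fzero∉M₂ α∈ β∈ α≢β α₁∈ α₂∈ α₁≢α₂

    v-common : ∀ {γ δ} → M₃ a b γ → M₃ a b δ → γ ≢ δ → X o γ δ ≡ v
    v-common γ∈ δ∈ γ≢δ = similar-pair sim₃ fzero∉M₃ γ∈ δ∈ γ≢δ γ₁∈ γ₂∈ γ₁≢γ₂

    w-common : ∀ {α γ} → M₂ a α → M₃ a b γ → X o α γ ≡ w
    w-common {α} {γ} α∈ γ∈ = begin
      X o α γ   ≡⟨ similar-outer sim₃ fzero∉M₃ (M₂⇒∉M₃ α∈) γ∈ γ₁∈ ⟩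
      X o α γ₁  ≡⟨ symm₂₃ o α γ₁ ⟩
      X o γ₁ α  ≡⟨ similar-outer sim₂ fzero∉M₂ (M₃⇒∉M₂ γ₁∈) α∈ α₁∈ ⟩
      X o γ₁ α₁ ≡⟨ symm₂₃ o γ₁ α₁ ⟩
      X o α₁ γ₁ ∎

    x-common : Is223 a b X x
    x-common α β γ α∈ β∈ γ∈ α≢β = begin
      X α β γ    ≡⟨ rotate α β γ ⟩
      X γ α β    ≡⟨ similar-pair sim₂ (M₃⇒∉M₂ γ∈) α∈ β∈ α≢β α₁∈ α₂∈ α₁≢α₂ ⟩
      X γ α₁ α₂  ≡⟨ rotate α₁ α₂ γ ⟨
      X α₁ α₂ γ  ≡⟨ similar-outer sim₃ (M₂⇒∉M₃ α₁∈) (M₂⇒∉M₃ α₂∈) γ∈ γ₁∈ ⟩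
      X α₁ α₂ γ₁ ∎

    y-common : Is233 a b X y
    y-common α β γ α∈ β∈ γ∈ β≢γ = begin
      X α β γ    ≡⟨ similar-pair sim₃ (M₂⇒∉M₃ α∈) β∈ γ∈ β≢γ γ₁∈ γ₂∈ γ₁≢γ₂ ⟩
      X α γ₁ γ₂  ≡⟨ rotate γ₁ γ₂ α ⟨
      X γ₁ γ₂ α  ≡⟨ similar-outer sim₂ (M₃⇒∉M₂ γ₁∈) (M₃⇒∉M₂ γ₂∈) α∈ α₁∈ ⟩
      X γ₁ γ₂ α₁ ≡⟨ rotate γ₁ γ₂ α₁ ⟩
      X α₁ γ₁ γ₂ ∎

    s₂-common : ∀ {α β γ} → M₂ a α → M₂ a β → M₂ a γ → α ≢ β → β ≢ γ → α ≢ γ → X α β γ ≡ s₂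
    s₂-common α∈ β∈ γ∈ α≢β β≢γ α≢γ =
      similar-inner sim₂ α∈ β∈ γ∈ α≢β β≢γ α≢γ α₁∈ α₂∈ α₃∈ α₁≢α₂ α₂≢α₃ α₁≢α₃

    s₃-common : ∀ {α β γ} → M₃ a b α → M₃ a b β → M₃ a b γ → α ≢ β → β ≢ γ → α ≢ γ → X α β γ ≡ s₃
    s₃-common α∈ β∈ γ∈ α≢β β≢γ α≢γ =
      similar-inner sim₃ α∈ β∈ γ∈ α≢β β≢γ α≢γ γ₁∈ γ₂∈ γ₃∈ γ₁≢γ₂ γ₂≢γ₃ γ₁≢γ₃

    private
      V : Class → Class → Class → ℚ
      V = classValue u v w x y s₂ s₃

      row-identity : ∀ {i j ci cj} → cls i ≡ ci → cls j ≡ cj → i ≢ j →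
                     (o ≢ i → o ≢ j → X i j o ≡ V ci cj C₁) →
                     (∀ l → M₂ a l → l ≢ i → l ≢ j → X i j l ≡ V ci cj C₂) →
                     (∀ l → M₃ a b l → l ≢ i → l ≢ j → X i j l ≡ V ci cj C₃) →
                     classRowSum (ℕ→ℚ a) (ℕ→ℚ b) V ci cj ≡ H ci * H cj
      row-identity {i} {j} refl refl i≢j at₁ at₂ at₃ = begin
        classRowSum (ℕ→ℚ a) (ℕ→ℚ b) V (cls i) (cls j)
          ≡⟨ sumFin-classwise {g = V (cls i) (cls j)} i≢j (X-iji≡0 i≢j) (X-ijj≡0 i≢j)
               (classwise {g = V (cls i) (cls j)} at₁ at₂ at₃) ⟨
        sumFin k (X i j)
          ≡⟨ rowSum i j ⟩
        Pseq a b h₁ h₂ h₃ i * Pseq a b h₁ h₂ h₃ j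
          ≡⟨ cong₂ _*_ (Pseq-height h₁ h₂ h₃ i) (Pseq-height h₁ h₂ h₃ j) ⟩
        H (cls i) * H (cls j)
          ∎

      excluded : ∀ {j} {t : ℚ} → o ≢ o → o ≢ j → X o j o ≡ t
      excluded o≢o _ = contradiction refl o≢o

      α₁≢γ₁ : α₁ ≢ γ₁
      α₁≢γ₁ = ∈∉⇒≢ {P = M₂ a} α₁∈ (M₃⇒∉M₂ γ₁∈)

    open LinearSystem (ℕ→ℚ a) (ℕ→ℚ b) (ℕ→ℚ h₁) (ℕ→ℚ h₂) (ℕ→ℚ h₃) x y
      using (RowEquations; Solution; module Rows)
    open Rows u v w s₂ s₃

    rowEquations : RowEquations u v w s₂ s₃
    rowEquations = record
      { row₁₂ = trans (sym rowSum₁₂) (row-identity refl refl (λ ()) excluded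
          (λ l l∈ _ l≢α₁ → u-common α₁∈ l∈ (l≢α₁ ∘ sym))
          (λ l l∈ _ _ → w-common α₁∈ l∈))
      ; row₁₃ = trans (sym rowSum₁₃) (row-identity refl (M₃⇒C₃ γ₁∈) (λ ()) excluded
          (λ l l∈ _ _ → trans (symm₂₃ o γ₁ l) (w-common l∈ γ₁∈))
          (λ l l∈ _ l≢γ₁ → v-common γ₁∈ l∈ (l≢γ₁ ∘ sym)))
      ; row₂₂ = trans (sym rowSum₂₂) (row-identity refl refl α₁≢α₂
          (λ _ _ → rotate α₁ α₂ o)
          (λ l l∈ l≢α₁ l≢α₂ → s₂-common α₁∈ α₂∈ l∈ α₁≢α₂ (l≢α₂ ∘ sym) (l≢α₁ ∘ sym))
          (λ l l∈ _ _ → x-common α₁ α₂ l α₁∈ α₂∈ l∈ α₁≢α₂))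
      ; row₂₃ = trans (sym rowSum₂₃) (row-identity refl (M₃⇒C₃ γ₁∈) α₁≢γ₁
          (λ _ _ → rotate α₁ γ₁ o)
          (λ l l∈ l≢α₁ _ → trans (symm₂₃ α₁ γ₁ l) (x-common α₁ l γ₁ α₁∈ l∈ γ₁∈ (l≢α₁ ∘ sym)))
          (λ l l∈ _ l≢γ₁ → y-common α₁ γ₁ l α₁∈ γ₁∈ l∈ (l≢γ₁ ∘ sym)))
      ; row₃₃ = trans (sym rowSum₃₃) (row-identity (M₃⇒C₃ γ₁∈) (M₃⇒C₃ γ₂∈) γ₁≢γ₂
          (λ _ _ → rotate γ₁ γ₂ o)
          (λ l l∈ _ _ → trans (rotate γ₁ γ₂ l) (y-common l γ₁ γ₂ l∈ γ₁∈ γ₂∈ γ₁≢γ₂))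
          (λ l l∈ l≢γ₁ l≢γ₂ → s₃-common γ₁∈ γ₂∈ l∈ γ₁≢γ₂ (l≢γ₂ ∘ sym) (l≢γ₁ ∘ sym)))
      }

    solution : Solution
    solution = record
      { u = u ; v = v ; w = w ; s₂ = s₂ ; s₃ = s₃
      ; u≥0 = nonneg o α₁ α₂ ; v≥0 = nonneg o γ₁ γ₂ ; w≥0 = nonneg o α₁ γ₁
      ; s₂≥0 = nonneg α₁ α₂ α₃ ; s₃≥0 = nonneg γ₁ γ₂ γ₃
      ; equations = rowEquations
      }

    similar-ROS⇒conditions : Σ ℚ λ x → Σ ℚ λ y → Is223 a b X x × Is233 a b X y × Conditions a b h₁ h₂ h₃ x y
    similar-ROS⇒conditions =
      x , y , x-common , y-common ,
      Conditions⇔Solution.solution⇒conditions a b h₁ h₂ h₃ x y 2<a 2<b (nonneg α₁ α₂ γ₁) (nonneg α₁ γ₁ γ₂) solution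

module Construction (a₀ b₀ h₁ h₂ h₃ : ℕ) (x y : ℚ) where
  private
    a b k : ℕ
    a = 3 ℕ.+ a₀
    b = 3 ℕ.+ b₀
    k = 1 ℕ.+ a ℕ.+ b
    2<a : 2 ℕ.< a
    2<a = s≤s (s≤s (s≤s z≤n))
    2<b : 2 ℕ.< b
    2<b = s≤s (s≤s (s≤s z≤n))
    H : Class → ℚ
    H = height (ℕ→ℚ h₁) (ℕ→ℚ h₂) (ℕ→ℚ h₃)
    P : Fin k → ℚ
    P = Pseq a b h₁ h₂ h₃
  open Positions a b
  open LinearSystem (ℕ→ℚ a) (ℕ→ℚ b) (ℕ→ℚ h₁) (ℕ→ℚ h₂) (ℕ→ℚ h₃) x y using (Solution; module Rows)

  module _ (sol : Solution) (0≤x : 0ℚ ≤ x) (0≤y : 0ℚ ≤ y) where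
    open Solution sol
    open Rows u v w s₂ s₃ using (rowEquations⇒rowSums)

    private
      V : Class → Class → Class → ℚ
      V = classValue u v w x y s₂ s₃

    X : Triple k
    X i j l with i ≟ j | j ≟ l | i ≟ l
    ... | yes _ | yes _ | _    = P i * P i
    ... | no _  | no _  | no _ = V (cls i) (cls j) (cls l)
    ... | _     | _     | _    = 0ℚ

    X-iii : ∀ i → X i i i ≡ P i * P i
    X-iii i with i ≟ i
    ... | yes _   = refl
    ... | no i≢i = contradiction refl i≢i

    X-iij≡0 : ∀ {i j} → i ≢ j → X i i j ≡ 0ℚ
    X-iij≡0 {i} {j} i≢j with i ≟ i | i ≟ j
    ... | yes _ | yes i≡j = contradiction i≡j i≢j
    ... | yes _ | no _    = refl
    ... | no i≢i | _      = contradiction refl i≢i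

    X-ijj≡0 : ∀ {i j} → i ≢ j → X i j j ≡ 0ℚ
    X-ijj≡0 {i} {j} i≢j with i ≟ j | j ≟ j
    ... | yes i≡j | _      = contradiction i≡j i≢j
    ... | no _    | yes _  = refl
    ... | no _    | no j≢j = contradiction refl j≢j

    X-iji≡0 : ∀ {i j} → i ≢ j → X i j i ≡ 0ℚ
    X-iji≡0 {i} {j} i≢j with i ≟ j | j ≟ i | i ≟ i
    ... | yes i≡j | _     | _      = contradiction i≡j i≢j
    ... | no _    | yes _ | _      = refl
    ... | no _    | no _  | yes _  = refl
    ... | no _    | no _  | no i≢i = contradiction refl i≢i

    X-distinct : ∀ {i j l} → i ≢ j → j ≢ l → i ≢ l → X i j l ≡ V (cls i) (cls j) (cls l)
    X-distinct {i} {j} {l} i≢j j≢l i≢l with i ≟ j | j ≟ l | i ≟ l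
    ... | yes i≡j | _       | _       = contradiction i≡j i≢j
    ... | no _    | yes j≡l | _       = contradiction j≡l j≢l
    ... | no _    | no _    | yes i≡l = contradiction i≡l i≢l
    ... | no _    | no _    | no _    = refl

    X-nonNeg : ∀ i j l → 0ℚ ≤ X i j l
    X-nonNeg i j l with i ≟ j | j ≟ l | i ≟ l
    ... | yes _ | yes _ | _    = *-nonNeg (P-nonNeg i) (P-nonNeg i)
      where
      P-nonNeg : ∀ i → 0ℚ ≤ P i
      P-nonNeg i = subst (0ℚ ≤_) (sym (Pseq-height h₁ h₂ h₃ i)) (H-nonNeg (cls i))
        where
        H-nonNeg : ∀ c → 0ℚ ≤ H c
        H-nonNeg C₁ = ℕ→ℚ-nonNeg h₁
        H-nonNeg C₂ = ℕ→ℚ-nonNeg h₂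
        H-nonNeg C₃ = ℕ→ℚ-nonNeg h₃
    ... | yes _ | no _  | _     = ≤-refl
    ... | no _  | yes _ | _     = ≤-refl
    ... | no _  | no _  | yes _ = ≤-refl
    ... | no _  | no _  | no _  = classValue-nonNeg u≥0 v≥0 w≥0 0≤x 0≤y s₂≥0 s₃≥0 (cls i) (cls j) (cls l)

    X-comm₁₂ : ∀ i j l → X i j l ≡ X j i l
    X-comm₁₂ i j l = by-cases i j l (i ≟ j) (j ≟ l) (i ≟ l)
      where
      by-cases : ∀ i j l → Dec (i ≡ j) → Dec (j ≡ l) → Dec (i ≡ l) → X i j l ≡ X j i l
      by-cases i .i l (yes refl) _ _ = refl
      by-cases i j .j (no i≢j) (yes refl) _ = trans (X-ijj≡0 i≢j) (sym (X-iji≡0 (≢-sym i≢j)))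
      by-cases i j .i (no i≢j) (no _) (yes refl) = trans (X-iji≡0 i≢j) (sym (X-ijj≡0 (≢-sym i≢j)))
      by-cases i j l (no i≢j) (no j≢l) (no i≢l) =
        trans (X-distinct i≢j j≢l i≢l)
              (trans (classValue-comm₁₂ (cls i) (cls j) (cls l)) (sym (X-distinct (≢-sym i≢j) i≢l j≢l)))

    X-comm₂₃ : ∀ i j l → X i j l ≡ X i l j
    X-comm₂₃ i j l = by-cases i j l (j ≟ l) (i ≟ j) (i ≟ l)
      where
      by-cases : ∀ i j l → Dec (j ≡ l) → Dec (i ≡ j) → Dec (i ≡ l) → X i j l ≡ X i l j
      by-cases i j .j (yes refl) _ _ = refl
      by-cases i .i l (no i≢l) (yes refl) _ = trans (X-iij≡0 i≢l) (sym (X-iji≡0 i≢l))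
      by-cases i j .i (no j≢i) (no i≢j) (yes refl) = trans (X-iji≡0 i≢j) (sym (X-iij≡0 i≢j))
      by-cases i j l (no j≢l) (no i≢j) (no i≢l) =
        trans (X-distinct i≢j j≢l i≢l)
              (trans (classValue-comm₂₃ (cls i) (cls j) (cls l)) (sym (X-distinct i≢l (≢-sym j≢l) i≢j)))

    X-rowSum : ∀ i j → sumFin k (X i j) ≡ P i * P j
    X-rowSum i j = by-cases i j (i ≟ j)
      where
      by-cases : ∀ i j → Dec (i ≡ j) → sumFin k (X i j) ≡ P i * P j
      by-cases i .i (yes refl) = trans (sumFin-single k (X i i) i λ l l≢i → X-iij≡0 (≢-sym l≢i)) (X-iii i)
      by-cases i j (no i≢j) = begin
        sumFin k (X i j)
          ≡⟨ sumFin-classwise {g = V (cls i) (cls j)} i≢j (X-iji≡0 i≢j) (X-ijj≡0 i≢j)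
               (λ l l≢i l≢j → X-distinct i≢j (≢-sym l≢j) (≢-sym l≢i)) ⟩
        classRowSum (ℕ→ℚ a) (ℕ→ℚ b) V (cls i) (cls j)
          ≡⟨ rowEquations⇒rowSums equations (cls i) (cls j) not-both-C₁ ⟩
        H (cls i) * H (cls j)
          ≡⟨ cong₂ _*_ (Pseq-height h₁ h₂ h₃ i) (Pseq-height h₁ h₂ h₃ j) ⟨
        P i * P j
          ∎
        where
        not-both-C₁ : cls i ≡ C₁ → cls j ≢ C₁
        not-both-C₁ i∈C₁ j∈C₁ = i≢j (trans (C₁⇒fzero i∈C₁) (sym (C₁⇒fzero j∈C₁)))

    X-isROS : IsROS k P X
    X-isROS = record
      { nonneg  = X-nonNeg
      ; symm₁₂  = X-comm₁₂
      ; symm₂₃  = X-comm₂₃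
      ; rowSum  = X-rowSum
      ; diag    = X-iii
      ; zeroIIJ = λ _ _ → X-iij≡0
      }

    private
      V-cong : ∀ {c c′ d d′ e e′} → c ≡ c′ → d ≡ d′ → e ≡ e′ → V c d e ≡ V c′ d′ e′
      V-cong refl refl refl = refl

      X-third : ∀ {i j l l′} → l ≢ i → l ≢ j → l′ ≢ i → l′ ≢ j → cls l ≡ cls l′ → X i j l ≡ X i j l′
      X-third {i} {j} {l} {l′} l≢i l≢j l′≢i l′≢j same-class = by-cases i j (i ≟ j) l≢i l≢j l′≢i l′≢j
        where
        by-cases : ∀ i j → Dec (i ≡ j) → l ≢ i → l ≢ j → l′ ≢ i → l′ ≢ j → X i j l ≡ X i j l′
        by-cases i .i (yes refl) l≢i _ l′≢i _ = trans (X-iij≡0 (≢-sym l≢i)) (sym (X-iij≡0 (≢-sym l′≢i)))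
        by-cases i j (no i≢j) l≢i l≢j l′≢i l′≢j =
          trans (X-distinct i≢j (≢-sym l≢j) (≢-sym l≢i))
                (trans (cong (V (cls i) (cls j)) same-class) (sym (X-distinct i≢j (≢-sym l′≢j) (≢-sym l′≢i))))

    X-similar : ∀ {c m} cl → (∀ {l} → InBlock c m l → cls l ≡ cl) →
                ∀ {p q} → InBlock c m p → InBlock c m q → p ≢ q → Similar k X c m
    X-similar {c} {m} cl ⊆cl {p} {q} p∈ q∈ p≢q =
      (λ i j → X i j p) , (λ i → X i p q) , V cl cl cl ,
      (λ i j _ _ → X-nonNeg i j p) , (λ i _ → X-nonNeg i p q) ,
      classValue-nonNeg u≥0 v≥0 w≥0 0≤x 0≤y s₂≥0 s₃≥0 cl cl cl ,
      (λ i j α i∉ j∉ α∈ →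
         X-third (apart α∈ i∉) (apart α∈ j∉) (apart p∈ i∉) (apart p∈ j∉) (trans (⊆cl α∈) (sym (⊆cl p∈)))) ,
      (λ i α β i∉ α∈ β∈ α≢β → trans (X-pair i∉ α∈ β∈ α≢β) (sym (X-pair i∉ p∈ q∈ p≢q))) ,
      (λ α β γ α∈ β∈ γ∈ α≢β β≢γ α≢γ → trans (X-distinct α≢β β≢γ α≢γ) (V-cong (⊆cl α∈) (⊆cl β∈) (⊆cl γ∈)))
      where
      apart : ∀ {l l′} → InBlock c m l → ¬ InBlock c m l′ → l ≢ l′
      apart = ∈∉⇒≢ {P = InBlock c m}
      X-pair : ∀ {i α β} → ¬ InBlock c m i → InBlock c m α → InBlock c m β → α ≢ β → X i α β ≡ V (cls i) cl cl
      X-pair {i} i∉ α∈ β∈ α≢β =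
        trans (X-distinct (≢-sym (apart α∈ i∉)) α≢β (≢-sym (apart β∈ i∉))) (cong₂ (V (cls i)) (⊆cl α∈) (⊆cl β∈))

    X-is223 : Is223 a b X x
    X-is223 α β γ α∈ β∈ γ∈ α≢β =
      trans (X-distinct α≢β (∈∉⇒≢ {P = M₂ a} β∈ (M₃⇒∉M₂ γ∈)) (∈∉⇒≢ {P = M₂ a} α∈ (M₃⇒∉M₂ γ∈)))
            (V-cong (M₂⇒C₂ α∈) (M₂⇒C₂ β∈) (M₃⇒C₃ γ∈))

    X-is233 : Is233 a b X y
    X-is233 α β γ α∈ β∈ γ∈ β≢γ =
      trans (X-distinct (∈∉⇒≢ {P = M₂ a} α∈ (M₃⇒∉M₂ β∈)) β≢γ (∈∉⇒≢ {P = M₂ a} α∈ (M₃⇒∉M₂ γ∈)))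
            (V-cong (M₂⇒C₂ α∈) (M₃⇒C₃ β∈) (M₃⇒C₃ γ∈))

    solution⇒similar-ROS : Σ (Triple k) λ X → IsROS k P X × Similar k X 1 a × Similar k X (1 ℕ.+ a) b ×
                                     Is223 a b X x × Is233 a b X y
    solution⇒similar-ROS =
      X , X-isROS ,
      X-similar C₂ M₂⇒C₂ (pos₂∈M₂ fzero) (pos₂∈M₂ (fsuc fzero)) ((λ ()) ∘ pos₂-injective) ,
      X-similar C₃ M₃⇒C₃ (pos₃∈M₃ fzero) (pos₃∈M₃ (fsuc fzero)) ((λ ()) ∘ pos₃-injective) ,
      X-is223 , X-is233

  conditions⇒similar-ROS : Conditions a b h₁ h₂ h₃ x y →
                           Σ (Triple k) λ X → IsROS k P X × Similar k X 1 a × Similar k X (1 ℕ.+ a) b ×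
                                              Is223 a b X x × Is233 a b X y
  conditions⇒similar-ROS conditions@(0≤x , 0≤y , _) =
    solution⇒similar-ROS (Conditions⇔Solution.conditions⇒solution a b h₁ h₂ h₃ x y 2<a 2<b conditions) 0≤x 0≤y

mainTheorem16 :
    (a b h₁ h₂ h₃ : ℕ) → 3 ℕ.≤ a → 3 ℕ.≤ b → 0 ℕ.< h₁ → 0 ℕ.< h₂ → 0 ℕ.< h₃ →
    -- (⇒) every ROS(P) similar w.r.t. M₂ and M₃ has common values x = X'(2,2,3), y = X'(2,3,3) satisfying (1)–(4)
    ((X : Triple (1 ℕ.+ a ℕ.+ b)) → IsROS (1 ℕ.+ a ℕ.+ b) (Pseq a b h₁ h₂ h₃) X →
       Similar (1 ℕ.+ a ℕ.+ b) X 1 a → Similar (1 ℕ.+ a ℕ.+ b) X (1 ℕ.+ a) b →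
       Σ ℚ λ x → Σ ℚ λ y → Is223 a b X x × Is233 a b X y × Conditions a b h₁ h₂ h₃ x y)
    ×
    -- (⇐) any rationals x, y satisfying (1)–(4) are X'(2,2,3), X'(2,3,3) of some such ROS(P)
    ((x y : ℚ) → Conditions a b h₁ h₂ h₃ x y →
       Σ (Triple (1 ℕ.+ a ℕ.+ b)) λ X → IsROS (1 ℕ.+ a ℕ.+ b) (Pseq a b h₁ h₂ h₃) X ×
         Similar (1 ℕ.+ a ℕ.+ b) X 1 a × Similar (1 ℕ.+ a ℕ.+ b) X (1 ℕ.+ a) b ×
         Is223 a b X x × Is233 a b X y)
mainTheorem16 (suc (suc (suc a₀))) (suc (suc (suc b₀))) h₁ h₂ h₃ (s≤s (s≤s (s≤s z≤n))) (s≤s (s≤s (s≤s z≤n))) _ _ _ =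
  Forward.similar-ROS⇒conditions a₀ b₀ h₁ h₂ h₃ ,
  λ x y → Construction.conditions⇒similar-ROS a₀ b₀ h₁ h₂ h₃ x y
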